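{- Let $A=\{a_1<a_2<\dots<a_m\}$ and $B=\{b_1<b_2<\dots<b_n\}$ be finite subsets of $\mathbb{Z}$ with $m\ge 5$, $n\ge 2$, $B\subseteq A$, and $|A\widehat{+}B|=|A|+|B|-3$. Then $a_m=b_n$, and the sets $X=A\setminus\{a_m\}$, $Y=B\setminus\{b_n\}$ satisfy $|X\widehat{+}Y|=|X|+|Y|-3$.
   Context: For finite sets $A,B\subseteq\mathbb{Z}$, the restricted sumset is $A\widehat{+}B=\{a+b: a\in A,\ b\in B,\ a\neq b\}$. A pair $(A,B)$ with $|A\widehat{+}B|=|A|+|B|-3$ is called a critical pair. -}

module Defs where

open import Data.Integer using (ℤ; _+_; _<_)
open import Data.List using (List; length)
open import Data.List.Membership.Propositional using (_∈_)
open import Data.List.Relation.Unary.AllPairs using (AllPairs)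
open import Data.Product using (∃; ∃₂; _×_; _,_)
open import Data.Nat using (ℕ)
open import Relation.Binary.PropositionalEquality using (_≡_; _≢_)
open import Function.Bundles using (_⇔_)

-- A finite subset of ℤ is represented by the strictly increasing list
-- of its elements (a₁ < a₂ < … < aₘ); its cardinality is the length.
StrictInc : List ℤ → Set
StrictInc = AllPairs _<_

InRestrSum : List ℤ → List ℤ → ℤ → Set
InRestrSum A B s = ∃₂ λ a b → a ∈ A × b ∈ B × a ≢ b × s ≡ a + b

EnumRestrSum : List ℤ → List ℤ → List ℤ → Set
EnumRestrSum A B S = StrictInc S × (∀ s → s ∈ S ⇔ InRestrSum A B s)

RestrSumCard : List ℤ → List ℤ → ℕ → Set
RestrSumCard A B k = ∃ λ S → EnumRestrSum A B S × length S ≡ k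

-- (A, B) is a critical pair: |A +̂ B| = |A| + |B| - 3, written as |A +̂ B| + 3 = |A| + |B| over ℕ
Critical : List ℤ → List ℤ → Set
Critical A B = ∃ λ k → RestrSumCard A B k × k Data.Nat.+ 3 ≡ length A Data.Nat.+ length B

-- The general bound |A +̂ B| ≥ |A| + |B| − 3, sharpened to |A| + |B| − 2 when A ≠ B,
-- goes by removing maximal elements.  If max A = a > max B = b, dropping a loses the
-- sum a + b, which exceeds every remaining sum (when the rest of A equals B it loses
-- two, a + a' and a + a'', which pays for the weaker bound on the symmetric pair).
-- If max A = max B = a, dropping a from both loses two sums a + x above all others.
-- Hence a critical pair has A = B, so aₘ = bₙ.  With a > a' > a'' the top of A, the sums a + a' > a + a'' exceed
-- X +̂ X, so |X +̂ X| ≤ |A +̂ A| − 2 = 2|X| − 3, the general bound reversed.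
module Submission where

open import Defs
open import Data.Integer using (ℤ; _<_)
open import Data.Nat using (_≤_)
open import Data.List using (List; length; _∷ʳ_)
open import Data.List.Membership.Propositional using (_∈_)
open import Data.Product using (_×_; _,_)
open import Relation.Binary.PropositionalEquality using (_≡_)

import Data.Integer as ℤ
import Data.Integer.Properties as ℤ
import Data.Nat as ℕ
import Data.Nat.Properties as ℕ
open import Algebra.Properties.CommutativeSemigroup ℕ.+-commutativeSemigroup
  using (x∙yz≈y∙xz; x∙yz≈yx∙z)
open import Data.Nat using (ℕ; suc; _+_; z≤n; s≤s)
open import Data.List using ([]; _∷_; [_]; filter; reverse)
import Data.List.Properties as List
open import Data.List.Relation.Unary.All as All using (All; []; _∷_)
open import Data.List.Relation.Unary.Any using (Any; here; there; any?)
import Data.List.Relation.Unary.Any.Properties as Any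
open import Data.List.Relation.Unary.AllPairs using (AllPairs; []; _∷_)
import Data.List.Relation.Unary.AllPairs.Properties as AllPairs
open import Data.List.Membership.Propositional using (find; lose)
open import Data.List.Membership.Propositional.Properties using (∈-filter⁺; ∈-filter⁻)
open import Data.List.Relation.Binary.Subset.Propositional using (_⊆_)
open import Data.List.Relation.Binary.Permutation.Propositional using (_↭_; ↭-sym)
open import Data.List.Relation.Binary.Permutation.Propositional.Properties
  using (∈-resp-↭; ↭-length; ↭-reverse)
open import Data.Product using (∃₂; proj₁; proj₂)
open import Data.Sum using (_⊎_; inj₁; inj₂)
open import Data.Empty using (⊥-elim)
open import Function using (id; _∘′_)
open import Function.Bundles using (mk⇔; Equivalence)
open import Relation.Nullary using (¬_; yes; no; ¬?)
open import Relation.Nullary.Decidable using (map′; _×-dec_)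
open import Relation.Unary using (Decidable)
open import Relation.Binary.Definitions using (tri<; tri≈; tri>)
open import Relation.Binary.PropositionalEquality
  using (_≢_; refl; sym; trans; cong; cong₂; subst; ≢-sym)

+-≤-shift : ∀ {m n s} d e {k k'} → m ≤ n + k → e + n ≤ s → d + k ≤ e + k' → d + m ≤ s + k'
+-≤-shift {m} {n} {s} d e {k} {k'} m≤n+k e+n≤s d+k≤e+k' = begin
  d + m         ≤⟨ ℕ.+-monoʳ-≤ d m≤n+k ⟩
  d + (n + k)   ≡⟨ x∙yz≈y∙xz d n k ⟩
  n + (d + k)   ≤⟨ ℕ.+-monoʳ-≤ n d+k≤e+k' ⟩
  n + (e + k')  ≡⟨ x∙yz≈yx∙z n e k' ⟩
  (e + n) + k'  ≤⟨ ℕ.+-monoˡ-≤ k' e+n≤s ⟩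
  s + k'        ∎
  where open ℕ.≤-Reasoning

+-mono-≤-flip : ∀ {d m n k} → m ≤ n → d ≤ k → d + m ≤ n + k
+-mono-≤-flip {d} {m} m≤n d≤k = ℕ.≤-trans (ℕ.≤-reflexive (ℕ.+-comm d m)) (ℕ.+-mono-≤ m≤n d≤k)

module _ {a p} {A : Set a} {P : A → Set p} (P? : Decidable P) where

  filter-notAll₂ : ∀ {xs u v} → u ∈ xs → v ∈ xs → u ≢ v → ¬ P u → ¬ P v →
                   2 + length (filter P? xs) ≤ length xs
  filter-notAll₂ (here refl) (here refl) u≢v _ _ = ⊥-elim (u≢v refl)
  filter-notAll₂ {xs = x ∷ xs} (here refl) (there v∈) _ ¬Pu ¬Pv
    rewrite List.filter-reject P? {xs = xs} ¬Pu = s≤s (List.filter-notAll P? xs (lose v∈ ¬Pv))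
  filter-notAll₂ {xs = x ∷ xs} (there u∈) (here refl) _ ¬Pu ¬Pv
    rewrite List.filter-reject P? {xs = xs} ¬Pv = s≤s (List.filter-notAll P? xs (lose u∈ ¬Pu))
  filter-notAll₂ {xs = x ∷ xs} (there u∈) (there v∈) u≢v ¬Pu ¬Pv with P? x
  ... | yes _ = s≤s (filter-notAll₂ u∈ v∈ u≢v ¬Pu ¬Pv)
  ... | no _  = ℕ.m≤n⇒m≤1+n (filter-notAll₂ u∈ v∈ u≢v ¬Pu ¬Pv)

StrictDec : List ℤ → Set
StrictDec = AllPairs ℤ._>_

strictDec⇒≤head : ∀ {a A} → StrictDec (a ∷ A) → All (ℤ._≤ a) (a ∷ A)
strictDec⇒≤head (A<a ∷ _) = ℤ.≤-refl ∷ All.map ℤ.<⇒≤ A<a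

restrSum? : ∀ A B → Decidable (InRestrSum A B)
restrSum? A B s = map′ to from (any? (λ x → any? (λ y → ¬? (x ℤ.≟ y) ×-dec (s ℤ.≟ x ℤ.+ y)) B) A)
  where
  to : Any (λ x → Any (λ y → x ≢ y × s ≡ x ℤ.+ y) B) A → InRestrSum A B s
  to p with x , x∈ , q ← find p with y , y∈ , x≢y , s≡ ← find q = x , y , x∈ , y∈ , x≢y , s≡
  from : InRestrSum A B s → Any (λ x → Any (λ y → x ≢ y × s ≡ x ℤ.+ y) B) A
  from (x , y , x∈ , y∈ , x≢y , s≡) = lose x∈ (lose y∈ (x≢y , s≡))

restrSum-mono : ∀ {A A' B B' s} → A ⊆ A' → B ⊆ B' → InRestrSum A B s → InRestrSum A' B' s
restrSum-mono A⊆ B⊆ (x , y , x∈ , y∈ , x≢y , s≡) = x , y , A⊆ x∈ , B⊆ y∈ , x≢y , s≡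

restrSum-comm : ∀ {A B s} → InRestrSum A B s → InRestrSum B A s
restrSum-comm (x , y , x∈ , y∈ , x≢y , s≡) = y , x , y∈ , x∈ , ≢-sym x≢y , trans s≡ (ℤ.+-comm x y)

restrSum-≤ : ∀ {A B α β s} → All (ℤ._≤ α) A → All (ℤ._≤ β) B → InRestrSum A B s → s ℤ.≤ α ℤ.+ β
restrSum-≤ A≤α B≤β (_ , _ , x∈ , y∈ , _ , refl) = ℤ.+-mono-≤ (All.lookup A≤α x∈) (All.lookup B≤β y∈)

-- A sum may use the common element a at most once.
restrSum-sharedHead-≤ : ∀ {a c A B s} → All (ℤ._≤ c) A → All (ℤ._≤ c) B → c ℤ.≤ a →
                        InRestrSum (a ∷ A) (a ∷ B) s → s ℤ.≤ a ℤ.+ c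
restrSum-sharedHead-≤ _ _ _ (_ , _ , here refl , here refl , a≢a , _) = ⊥-elim (a≢a refl)
restrSum-sharedHead-≤ {a} _ B≤c _ (_ , _ , here refl , there y∈ , _ , refl) =
  ℤ.+-monoʳ-≤ a (All.lookup B≤c y∈)
restrSum-sharedHead-≤ {a} A≤c _ _ (x , _ , there x∈ , here refl , _ , refl) =
  subst (ℤ._≤ a ℤ.+ _) (ℤ.+-comm a x) (ℤ.+-monoʳ-≤ a (All.lookup A≤c x∈))
restrSum-sharedHead-≤ A≤c B≤c c≤a (_ , _ , there x∈ , there y∈ , _ , refl) =
  ℤ.+-mono-≤ (ℤ.≤-trans (All.lookup A≤c x∈) c≤a) (All.lookup B≤c y∈)

enumRestrSum-resp : ∀ {A B A' B' S} → (∀ {s} → InRestrSum A B s → InRestrSum A' B' s) →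
                    (∀ {s} → InRestrSum A' B' s → InRestrSum A B s) →
                    EnumRestrSum A B S → EnumRestrSum A' B' S
enumRestrSum-resp to from (inc , mem) =
  inc , λ s → mk⇔ (to ∘′ Equivalence.to (mem s)) (Equivalence.from (mem s) ∘′ from)

enumRestrSum-comm : ∀ {A B S} → EnumRestrSum A B S → EnumRestrSum B A S
enumRestrSum-comm = enumRestrSum-resp restrSum-comm restrSum-comm

enumRestrSum-filter : ∀ {A B A' B' S} → A' ⊆ A → B' ⊆ B → EnumRestrSum A B S →
                      EnumRestrSum A' B' (filter (restrSum? A' B') S)
enumRestrSum-filter {A' = A'} {B'} {S} A'⊆ B'⊆ (inc , mem) =
  AllPairs.filter⁺ (restrSum? A' B') inc ,
  λ s → mk⇔ (λ s∈ → proj₂ (∈-filter⁻ (restrSum? A' B') {xs = S} s∈))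
            (λ p → ∈-filter⁺ (restrSum? A' B') (Equivalence.from (mem s) (restrSum-mono A'⊆ B'⊆ p)) p)

enumRestrSum-nonempty : ∀ {A B S s} → EnumRestrSum A B S → InRestrSum A B s → 1 ≤ length S
enumRestrSum-nonempty {s = s} (_ , mem) p with Equivalence.from (mem s) p
... | here _  = s≤s z≤n
... | there _ = s≤s z≤n

sumAbove⇒length< : ∀ {A B A' B' S u} → EnumRestrSum A B S → InRestrSum A B u →
                   (∀ {s} → InRestrSum A' B' s → s < u) →
                   length (filter (restrSum? A' B') S) ℕ.< length S
sumAbove⇒length< {A' = A'} {B'} {S} {u} (_ , mem) u∈ above =
  List.filter-notAll (restrSum? A' B') S (lose (Equivalence.from (mem u) u∈) λ p → ℤ.<-irrefl refl (above p))

TwoSumsAbove : List ℤ → List ℤ → List ℤ → List ℤ → Set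
TwoSumsAbove A B A' B' =
  ∃₂ λ u v → u < v × InRestrSum A B u × InRestrSum A B v × (∀ {s} → InRestrSum A' B' s → s < u)

twoSumsAbove⇒2+length≤ : ∀ {A B A' B' S} → TwoSumsAbove A B A' B' → EnumRestrSum A B S →
                         2 + length (filter (restrSum? A' B') S) ≤ length S
twoSumsAbove⇒2+length≤ {A' = A'} {B'} (u , v , u<v , u∈ , v∈ , above) (_ , mem) =
  filter-notAll₂ (restrSum? A' B') (Equivalence.from (mem u) u∈) (Equivalence.from (mem v) v∈)
    (ℤ.<⇒≢ u<v) (λ p → ℤ.<-irrefl refl (above p)) (λ p → ℤ.<-asym u<v (above p))

twoSumsAbove-sharedHead : ∀ {A₁ B₁ a a' c A B} → c < a' → a' < a → All (ℤ._≤ c) A → All (ℤ._≤ c) B →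
                          InRestrSum A₁ B₁ (c ℤ.+ a) → InRestrSum A₁ B₁ (a' ℤ.+ a) →
                          TwoSumsAbove A₁ B₁ (a' ∷ A) (a' ∷ B)
twoSumsAbove-sharedHead {a = a} {a'} {c} c<a' a'<a A≤c B≤c u∈ v∈ =
  _ , _ , ℤ.+-monoˡ-< a c<a' , u∈ , v∈ , λ p → ℤ.≤-<-trans (restrSum-sharedHead-≤ A≤c B≤c (ℤ.<⇒≤ c<a') p)
    (subst (_< c ℤ.+ a) (ℤ.+-comm c a') (ℤ.+-monoʳ-< c a'<a))

twoSumsAbove-< : ∀ {a a' A b' B} → a' < b' → StrictDec (a ∷ a' ∷ A) → StrictDec (a ∷ b' ∷ B) →
                 TwoSumsAbove (a ∷ a' ∷ A) (a ∷ b' ∷ B) (a' ∷ A) (b' ∷ B)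
twoSumsAbove-< {a} {a'} {b' = b'} a'<b' ((a'<a ∷ _) ∷ dA) ((b'<a ∷ _) ∷ dB) =
  a' ℤ.+ a , b' ℤ.+ a , ℤ.+-monoˡ-< a a'<b' ,
  (a' , a , there (here refl) , here refl , ℤ.<⇒≢ a'<a , refl) ,
  (a , b' , here refl , there (here refl) , ≢-sym (ℤ.<⇒≢ b'<a) , ℤ.+-comm b' a) ,
  λ p → ℤ.≤-<-trans (restrSum-≤ (strictDec⇒≤head dA) (strictDec⇒≤head dB) p) (ℤ.+-monoʳ-< a' b'<a)

twoSumsAbove-≡ : ∀ {a a' c A B} → c < a' → a' < a → c ∈ A ⊎ c ∈ B → All (ℤ._≤ c) A → All (ℤ._≤ c) B →
                 TwoSumsAbove (a ∷ a' ∷ A) (a ∷ a' ∷ B) (a' ∷ A) (a' ∷ B)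
twoSumsAbove-≡ {a} {a'} {c} {A} {B} c<a' a'<a c∈ A≤c B≤c =
  twoSumsAbove-sharedHead c<a' a'<a A≤c B≤c (c+a∈ c∈) (a' , a , there (here refl) , here refl , ℤ.<⇒≢ a'<a , refl)
  where
  c<a = ℤ.<-trans c<a' a'<a
  c+a∈ : c ∈ A ⊎ c ∈ B → InRestrSum (a ∷ a' ∷ A) (a ∷ a' ∷ B) (c ℤ.+ a)
  c+a∈ (inj₁ c∈A) = c , a , there (there c∈A) , here refl , ℤ.<⇒≢ c<a , refl
  c+a∈ (inj₂ c∈B) = a , c , here refl , there (there c∈B) , ≢-sym (ℤ.<⇒≢ c<a) , ℤ.+-comm c a

Bounds : List ℤ → List ℤ → ℕ → Set
Bounds A B k = (length A + length B ≤ k + 3) × (A ≢ B → length A + length B ≤ k + 2)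

LowerBound : List ℤ → List ℤ → Set
LowerBound A B = ∀ {S} → EnumRestrSum A B S → Bounds A B (length S)

bounds-strict : ∀ {A B k} → length A + length B ≤ k + 2 → Bounds A B k
bounds-strict {k = k} h = ℕ.≤-trans h (ℕ.+-monoʳ-≤ k (ℕ.n≤1+n 2)) , λ _ → h

lowerBound-comm : ∀ {A B} → LowerBound A B → LowerBound B A
lowerBound-comm {A} {B} lb {S} e with lb (enumRestrSum-comm e)
... | nonstrict , strict = swap nonstrict , λ B≢A → swap (strict (≢-sym B≢A))
  where
  swap : ∀ {k} → length A + length B ≤ k → length B + length A ≤ k
  swap {k} = subst (_≤ k) (ℕ.+-comm (length A) (length B))

length≤restrSum-singleton : ∀ {a B S} → StrictDec (a ∷ B) → EnumRestrSum [ a ] B S → length B ≤ length S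
length≤restrSum-singleton {B = []} _ _ = z≤n
length≤restrSum-singleton {a} {y ∷ B} ((y<a ∷ B<a) ∷ B<y ∷ dB) e =
  ℕ.≤-trans (s≤s (length≤restrSum-singleton (B<a ∷ dB) (enumRestrSum-filter id there e)))
    (sumAbove⇒length< e (a , y , here refl , here refl , ≢-sym (ℤ.<⇒≢ y<a) , refl) above)
  where
  above : ∀ {s} → InRestrSum [ a ] B s → s < a ℤ.+ y
  above (_ , _ , here refl , z∈ , _ , refl) = ℤ.+-monoʳ-< a (All.lookup B<y z∈)

lowerBound-singleton> : ∀ {a b B} → b < a → StrictDec (b ∷ B) → LowerBound [ a ] (b ∷ B)
lowerBound-singleton> {a} {b} {B} b<a dB@(B<b ∷ _) e =
  bounds-strict (+-mono-≤-flip (length≤restrSum-singleton dAB e) (ℕ.n≤1+n 1))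
  where
  dAB : StrictDec (a ∷ b ∷ B)
  dAB = (b<a ∷ All.map (λ x<b → ℤ.<-trans x<b b<a) B<b) ∷ dB

lowerBound-singleton≡ : ∀ {a B} → StrictDec (a ∷ B) → LowerBound [ a ] (a ∷ B)
lowerBound-singleton≡ {a} {B} dB e =
  bounds-strict (+-mono-≤-flip (length≤restrSum-singleton dB (enumRestrSum-resp dropSelf (restrSum-mono id there) e)) ℕ.≤-refl)
  where
  dropSelf : ∀ {s} → InRestrSum [ a ] (a ∷ B) s → InRestrSum [ a ] B s
  dropSelf (_ , _ , here refl , here refl , a≢a , _) = ⊥-elim (a≢a refl)
  dropSelf (x , y , here refl , there y∈ , x≢y , s≡) = x , y , here refl , y∈ , x≢y , s≡

lowerBound-∷-self : ∀ {a a' A} → StrictDec (a ∷ a' ∷ A) → LowerBound (a' ∷ A) (a' ∷ A) →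
                    LowerBound (a ∷ a' ∷ A) (a' ∷ A)
lowerBound-∷-self {a} {a'} {[]} ((a'<a ∷ _) ∷ _) _ e =
  bounds-strict (ℕ.+-monoˡ-≤ 2 (enumRestrSum-nonempty e (a , a' , here refl , here refl , ≢-sym (ℤ.<⇒≢ a'<a) , refl)))
lowerBound-∷-self {a} {a'} {c ∷ R} ((a'<a ∷ _) ∷ (c<a' ∷ _) ∷ dC) ih e =
  bounds-strict (+-≤-shift 1 2 (proj₁ (ih (enumRestrSum-filter there id e))) (twoSumsAbove⇒2+length≤ grows e) ℕ.≤-refl)
  where
  C≤c = strictDec⇒≤head dC
  grows : TwoSumsAbove (a ∷ a' ∷ c ∷ R) (a' ∷ c ∷ R) (a' ∷ c ∷ R) (a' ∷ c ∷ R)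
  grows = twoSumsAbove-sharedHead c<a' a'<a C≤c C≤c
    (a , c , here refl , there (here refl) , ≢-sym (ℤ.<⇒≢ (ℤ.<-trans c<a' a'<a)) , ℤ.+-comm c a)
    (a , a' , here refl , here refl , ≢-sym (ℤ.<⇒≢ a'<a) , ℤ.+-comm a' a)

lowerBound-> : ∀ {a a' A b B} → b < a → StrictDec (a ∷ a' ∷ A) → StrictDec (b ∷ B) →
               LowerBound (a' ∷ A) (b ∷ B) → LowerBound (a ∷ a' ∷ A) (b ∷ B)
lowerBound-> {a} {a'} {A} {b} {B} b<a dA@(A<a ∷ _) dB ih e with List.≡-dec ℤ._≟_ (a' ∷ A) (b ∷ B)
... | yes refl = lowerBound-∷-self dA ih e
... | no A≢B = bounds-strict (+-≤-shift 1 1 (proj₂ (ih e') A≢B) (sumAbove⇒length< e a+b∈ above) ℕ.≤-refl)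
  where
  e' = enumRestrSum-filter there id e
  a+b∈ : InRestrSum (a ∷ a' ∷ A) (b ∷ B) (a ℤ.+ b)
  a+b∈ = a , b , here refl , here refl , ≢-sym (ℤ.<⇒≢ b<a) , refl
  above : ∀ {s} → InRestrSum (a' ∷ A) (b ∷ B) s → s < a ℤ.+ b
  above (_ , _ , x∈ , y∈ , _ , refl) = ℤ.+-mono-<-≤ (All.lookup A<a x∈) (All.lookup (strictDec⇒≤head dB) y∈)

lowerBound-∷-both : ∀ {a A B} → TwoSumsAbove (a ∷ A) (a ∷ B) A B → LowerBound A B → LowerBound (a ∷ A) (a ∷ B)
lowerBound-∷-both {a} {A} {B} grows ih {S} e with ih (enumRestrSum-filter there there e)
... | nonstrict , strict =
  shift nonstrict , λ aA≢aB → shift (strict λ A≡B → aA≢aB (cong (a ∷_) A≡B))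
  where
  shift : ∀ {k} → length A + length B ≤ length (filter (restrSum? A B) S) + k →
          length (a ∷ A) + length (a ∷ B) ≤ length S + k
  shift {k} h = subst (_≤ length S + k) (cong suc (sym (ℕ.+-suc (length A) (length B))))
    (+-≤-shift 2 2 h (twoSumsAbove⇒2+length≤ grows e) ℕ.≤-refl)

lowerBound-≡-shared : ∀ {a a' A B} → StrictDec (a ∷ a' ∷ A) → StrictDec (a ∷ a' ∷ B) →
                      LowerBound (a' ∷ A) (a' ∷ B) → LowerBound (a ∷ a' ∷ A) (a ∷ a' ∷ B)
lowerBound-≡-shared {a} {a'} {[]} {[]} ((a'<a ∷ _) ∷ _) _ _ e =
  ℕ.+-monoˡ-≤ 3 (enumRestrSum-nonempty e (a' , a , there (here refl) , here refl , ℤ.<⇒≢ a'<a , refl)) ,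
  λ A≢A → ⊥-elim (A≢A refl)
lowerBound-≡-shared {A = _ ∷ _} {[]} ((a'<a ∷ _) ∷ (c<a' ∷ _) ∷ dA) _ =
  lowerBound-∷-both (twoSumsAbove-≡ c<a' a'<a (inj₁ (here refl)) (strictDec⇒≤head dA) [])
lowerBound-≡-shared {A = []} {_ ∷ _} ((a'<a ∷ _) ∷ _) (_ ∷ (d<a' ∷ _) ∷ dB) =
  lowerBound-∷-both (twoSumsAbove-≡ d<a' a'<a (inj₂ (here refl)) [] (strictDec⇒≤head dB))
lowerBound-≡-shared {A = c ∷ _} {d ∷ _} ((a'<a ∷ _) ∷ (c<a' ∷ _) ∷ dA) (_ ∷ (d<a' ∷ _) ∷ dB) with ℤ.≤-total d c
... | inj₁ d≤c = lowerBound-∷-both (twoSumsAbove-≡ c<a' a'<a (inj₁ (here refl))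
  (strictDec⇒≤head dA) (All.map (λ y≤d → ℤ.≤-trans y≤d d≤c) (strictDec⇒≤head dB)))
... | inj₂ c≤d = lowerBound-∷-both (twoSumsAbove-≡ d<a' a'<a (inj₂ (here refl))
  (All.map (λ x≤c → ℤ.≤-trans x≤c c≤d) (strictDec⇒≤head dA)) (strictDec⇒≤head dB))

lowerBound-≡ : ∀ {a a' A b' B} → StrictDec (a ∷ a' ∷ A) → StrictDec (a ∷ b' ∷ B) →
               LowerBound (a' ∷ A) (b' ∷ B) → LowerBound (a ∷ a' ∷ A) (a ∷ b' ∷ B)
lowerBound-≡ {a' = a'} {b' = b'} dA dB ih with ℤ.<-cmp a' b'
... | tri< a'<b' _ _ = lowerBound-∷-both (twoSumsAbove-< a'<b' dA dB) ih
... | tri> _ _ b'<a' = lowerBound-comm (lowerBound-∷-both (twoSumsAbove-< b'<a' dB dA) (lowerBound-comm ih))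
... | tri≈ _ refl _ = lowerBound-≡-shared dA dB ih

-- Lexicographic recursion on (A, B): the case a < b shortens B alone.
lowerBound : ∀ a A b B → StrictDec (a ∷ A) → StrictDec (b ∷ B) → LowerBound (a ∷ A) (b ∷ B)
lowerBound a A b B dA dB with ℤ.<-cmp a b
lowerBound a [] b B dA dB | tri> _ _ b<a = lowerBound-singleton> b<a dB
lowerBound a (a' ∷ A) b B dA dB | tri> _ _ b<a =
  lowerBound-> b<a dA dB (lowerBound a' A b B (AllPairs.drop⁺ 1 dA) dB)
lowerBound a A b [] dA dB | tri< a<b _ _ = lowerBound-comm (lowerBound-singleton> a<b dA)
lowerBound a A b (b' ∷ B) dA dB | tri< a<b _ _ =
  lowerBound-comm (lowerBound-> a<b dB dA (lowerBound-comm (lowerBound a A b' B dA (AllPairs.drop⁺ 1 dB))))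
lowerBound a [] .a B dA dB | tri≈ _ refl _ = lowerBound-singleton≡ dB
lowerBound a A .a [] dA dB | tri≈ _ refl _ = lowerBound-comm (lowerBound-singleton≡ dA)
lowerBound a (a' ∷ A) .a (b' ∷ B) dA dB | tri≈ _ refl _ =
  lowerBound-≡ dA dB (lowerBound a' A b' B (AllPairs.drop⁺ 1 dA) (AllPairs.drop⁺ 1 dB))

strictDec-reverse : ∀ {A} → StrictInc A → StrictDec (reverse A)
strictDec-reverse {[]} [] = []
strictDec-reverse {a ∷ A} (a<A ∷ inc) rewrite List.unfold-reverse a A =
  AllPairs.++⁺ (strictDec-reverse inc) ([] ∷ [])
    (All.tabulate λ x∈ → All.lookup a<A (Any.reverse⁻ x∈) ∷ [])

strictDec-∷reverse : ∀ {A a} → StrictInc (A ∷ʳ a) → StrictDec (a ∷ reverse A)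
strictDec-∷reverse {A} {a} inc = subst StrictDec (List.reverse-++ A [ a ]) (strictDec-reverse inc)

∷ʳ↭∷reverse : ∀ (A : List ℤ) a → A ∷ʳ a ↭ a ∷ reverse A
∷ʳ↭∷reverse A a = subst (A ∷ʳ a ↭_) (List.reverse-++ A [ a ]) (↭-sym (↭-reverse (A ∷ʳ a)))

critical-resp-↭ : ∀ {A A' B B'} → A ↭ A' → B ↭ B' → Critical A B → Critical A' B'
critical-resp-↭ A↭A' B↭B' (k , (S , e , |S|≡k) , crit) =
  k , (S , enumRestrSum-resp (restrSum-↭ A↭A' B↭B') (restrSum-↭ (↭-sym A↭A') (↭-sym B↭B')) e , |S|≡k) ,
  trans crit (cong₂ _+_ (↭-length A↭A') (↭-length B↭B'))
  where
  restrSum-↭ : ∀ {A A' B B' s} → A ↭ A' → B ↭ B' → InRestrSum A B s → InRestrSum A' B' s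
  restrSum-↭ A↭A' B↭B' = restrSum-mono (∈-resp-↭ A↭A') (∈-resp-↭ B↭B')

critical⇒≡ : ∀ {a A b B} → StrictDec (a ∷ A) → StrictDec (b ∷ B) → Critical (a ∷ A) (b ∷ B) → a ∷ A ≡ b ∷ B
critical⇒≡ {a} {A} {b} {B} dA dB (_ , (S , e , refl) , crit) with List.≡-dec ℤ._≟_ (a ∷ A) (b ∷ B)
... | yes A≡B = A≡B
... | no A≢B = ⊥-elim (ℕ.<-irrefl refl (ℕ.+-cancelˡ-≤ (length S) 3 2
  (subst (_≤ length S + 2) (sym crit) (proj₂ (lowerBound a A b B dA dB e) A≢B))))

critical-dropMax : ∀ {a D} → StrictDec (a ∷ D) → 3 ≤ length (a ∷ D) → Critical (a ∷ D) (a ∷ D) → Critical D D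
critical-dropMax {D = []} _ (s≤s ()) _
critical-dropMax {D = _ ∷ []} _ (s≤s (s≤s ())) _
critical-dropMax {a} {D@(a' ∷ c ∷ R)} ((a'<a ∷ _) ∷ dD@((c<a' ∷ _) ∷ dC)) _ (_ , (S , e , refl) , crit) =
  length S' , (S' , e' , refl) , ℕ.≤-antisym upper lower
  where
  S' = filter (restrSum? D D) S
  e' = enumRestrSum-filter there there e
  lower : length D + length D ≤ length S' + 3
  lower = proj₁ (lowerBound a' (c ∷ R) a' (c ∷ R) dD dD e')
  count : 2 + length S' ≤ length S
  count = twoSumsAbove⇒2+length≤
    (twoSumsAbove-≡ c<a' a'<a (inj₁ (here refl)) (strictDec⇒≤head dC) (strictDec⇒≤head dC)) e
  upper : length S' + 3 ≤ length D + length D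
  upper = ℕ.+-cancelˡ-≤ 2 _ _ (begin
    2 + (length S' + 3)                ≤⟨ ℕ.+-monoˡ-≤ 3 count ⟩
    length S + 3                       ≡⟨ crit ⟩
    length (a ∷ D) + length (a ∷ D)    ≡⟨ cong suc (ℕ.+-suc (length D) (length D)) ⟩
    2 + (length D + length D)          ∎)
    where open ℕ.≤-Reasoning

critical-∷ʳ⇒≡ : ∀ {X a Y b} → StrictInc (X ∷ʳ a) → StrictInc (Y ∷ʳ b) → Critical (X ∷ʳ a) (Y ∷ʳ b) → X ∷ʳ a ≡ Y ∷ʳ b
critical-∷ʳ⇒≡ {X} {a} {Y} {b} incA incB crit
  with a≡b , rX≡rY ← List.∷-injective (critical⇒≡ (strictDec-∷reverse incA) (strictDec-∷reverse incB)
                       (critical-resp-↭ (∷ʳ↭∷reverse X a) (∷ʳ↭∷reverse Y b) crit))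
  = cong₂ _∷ʳ_ (List.reverse-injective rX≡rY) a≡b

critical-∷ʳ-init : ∀ {X a} → StrictInc (X ∷ʳ a) → 3 ≤ length (X ∷ʳ a) → Critical (X ∷ʳ a) (X ∷ʳ a) → Critical X X
critical-∷ʳ-init {X} {a} inc 3≤|A| crit =
  critical-resp-↭ (↭-reverse X) (↭-reverse X)
    (critical-dropMax (strictDec-∷reverse inc) (subst (3 ≤_) (↭-length A↭) 3≤|A|) (critical-resp-↭ A↭ A↭ crit))
  where
  A↭ = ∷ʳ↭∷reverse X a

lemma3 : (A B : List ℤ) → StrictInc A → StrictInc B →
         5 ≤ length A → 2 ≤ length B →
         (∀ {x} → x ∈ B → x ∈ A) → Critical A B →
         (X Y : List ℤ) (am bn : ℤ) → A ≡ X ∷ʳ am → B ≡ Y ∷ʳ bn →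
         am ≡ bn × Critical X Y
lemma3 _ _ incA incB 5≤|A| _ _ crit X Y am bn refl refl
  with refl , refl ← List.∷ʳ-injective X Y (critical-∷ʳ⇒≡ incA incB crit)
  = refl , critical-∷ʳ-init incA (ℕ.≤-trans (ℕ.m≤m+n 3 2) 5≤|A|) crit
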